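{- Let $\mathcal{P}$ be the set of polynomials $(X-a)(X-b)$ with $a,b$ non-negative integers, $a\leq b$, totally ordered by the asymptotic order. Every primitive gap of $\mathcal{P}$ (a difference $g-f$ with $f,g\in\mathcal{P}$, $f<_{\mathrm{as}}g$, and no element of $\mathcal{P}$ strictly between $f$ and $g$) is either a positive integer (constant polynomial) or a polynomial of the form $X-\lfloor j^2/4\rfloor$ for some integer $j\geq 1$. More precisely, for each $j\geq 1$ the polynomial $X-\lfloor j^2/4\rfloor$ occurs as a primitive gap exactly once, and a positive integer $k\geq 1$ occurs as a primitive gap exactly between consecutive elements $(X-a)(X-(j-a))<_{\mathrm{as}}(X-(a+1))(X-(j-a-1))$ with $j-2a-1=k$.
   Context: For real polynomials $f,g$, write $f\leq_{\mathrm{as}} g$ if $f(x)\leq g(x)$ for all sufficiently large real $x$; this is a total order on $\mathbf{R}[X]$ making it an ordered abelian group, and $f<_{\mathrm{as}}g$ means $f\leq_{\mathrm{as}}g$ and $f\neq g$. -}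

module Defs where

open import Data.Nat as ℕ using (ℕ)
open import Data.Nat.DivMod using (_/_)
open import Data.Integer using (ℤ; +_; _+_; _*_; -_; _-_; _≤_; 0ℤ)
open import Data.List using (List; []; _∷_; map)
open import Data.List.Relation.Unary.All using (All)
open import Data.Product using (Σ; _×_; ∃; ∃-syntax; _,_)
open import Relation.Nullary using (¬_)
open import Relation.Binary.PropositionalEquality using (_≡_)

-- Real polynomials are replaced by integer-coefficient polynomials
-- (all polynomials in the statement have integer coefficients).
-- A polynomial is its list of coefficients, lowest degree first.
Poly : Set
Poly = List ℤ

infixl 6 _+ₚ_ _-ₚ_
infixl 7 _*ₚ_

_+ₚ_ : Poly → Poly → Poly
[] +ₚ q = q
(a ∷ p) +ₚ [] = a ∷ p
(a ∷ p) +ₚ (b ∷ q) = (a + b) ∷ (p +ₚ q)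

-ₚ_ : Poly → Poly
-ₚ p = map -_ p

_-ₚ_ : Poly → Poly → Poly
p -ₚ q = p +ₚ (-ₚ q)

scale : ℤ → Poly → Poly
scale c p = map (c *_) p

_*ₚ_ : Poly → Poly → Poly
[] *ₚ q = []
(a ∷ p) *ₚ q = scale a q +ₚ (0ℤ ∷ (p *ₚ q))

-- equality of polynomials: all coefficients of the difference vanish
-- (so trailing zero coefficients do not matter)
IsZeroPoly : Poly → Set
IsZeroPoly p = All (_≡ 0ℤ) p

infix 4 _≈ₚ_ _≤as_ _<as_

_≈ₚ_ : Poly → Poly → Set
p ≈ₚ q = IsZeroPoly (p -ₚ q)

Xₚ : Poly
Xₚ = 0ℤ ∷ + 1 ∷ []

constₚ : ℤ → Poly
constₚ c = c ∷ []

eval : Poly → ℤ → ℤ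
eval [] x = 0ℤ
eval (a ∷ p) x = a + x * eval p x

_≤as_ : Poly → Poly → Set
f ≤as g = ∃[ N ] (∀ (x : ℤ) → N ≤ x → eval f x ≤ eval g x)

_<as_ : Poly → Poly → Set
f <as g = (f ≤as g) × ¬ (f ≈ₚ g)

pab : ℕ → ℕ → Poly
pab a b = (Xₚ -ₚ constₚ (+ a)) *ₚ (Xₚ -ₚ constₚ (+ b))

Inℙ : Poly → Set
Inℙ f = Σ ℕ λ a → Σ ℕ λ b → (a ℕ.≤ b) × (f ≈ₚ pab a b)

PrimGapPair : Poly → Poly → Set
PrimGapPair f g =
  Inℙ f × Inℙ g × (f <as g) × (∀ h → Inℙ h → ¬ ((f <as h) × (h <as g)))

IsPrimitiveGap : Poly → Set
IsPrimitiveGap d = ∃[ f ] ∃[ g ] (PrimGapPair f g × (d ≈ₚ (g -ₚ f)))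

linGap : ℕ → Poly
linGap j = Xₚ -ₚ constₚ (+ ((j ℕ.* j) / 4))

{-# OPTIONS --safe #-}

-- Index the element (X - a)(X - (s - a)) of 𝒫 by its root sum s and its smaller root
-- a ≤ ⌊s/2⌋. It equals X² - sX + a(s - a), and X² - sX + p is eventually below X² - tX + q
-- iff -s < -t, or s = t and p < q. Since a(s - a) increases with a while a ≤ s/2, the
-- asymptotic order on 𝒫 is lexicographic in (s decreasing, a increasing). Its consecutive
-- pairs are therefore (s, a) < (s, a + 1), with constant difference
-- (a + 1)(s - a - 1) - a(s - a) = s - 2a - 1, and the last element (s + 1, ⌊(s + 1)/2⌋) of
-- one root sum followed by the first element (s, 0) of the next, with difference
-- X - ⌊(s + 1)/2⌋⌈(s + 1)/2⌉ = X - ⌊(s + 1)²/4⌋. Each linear gap occurs only once because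
-- n ↦ ⌊n²/4⌋ is injective on n ≥ 1.

module Submission where

open import Defs
open import Data.Nat as ℕ using (ℕ; zero; suc)
import Data.Nat.Properties as ℕₚ
open import Data.Product using (_×_; _,_; ∃-syntax; proj₁; proj₂)
open import Data.Sum using (_⊎_; inj₁; inj₂)
open import Data.List using ([]; _∷_)
open import Data.List.Relation.Unary.All using ([]; _∷_)
open import Relation.Binary.PropositionalEquality
open import Relation.Binary.Bundles using (Setoid)
open import Relation.Binary.Structures using (IsEquivalence)
open import Function using (_∘_; id)

module PolynomialEquality where
  open import Data.Integer using (ℤ; 0ℤ; +_; _+_; -_; _-_; _*_)
  open import Data.Integer.Properties
    using (+-identityˡ; +-identityʳ; i-j≡0⇒i≡j; i≡j⇒i-j≡0; *-zeroʳ; +-injective; neg-injective)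
  open import Data.Nat.DivMod using (_/_)
  open import Relation.Nullary using (¬_)
  open import Data.Integer.Tactic.RingSolver using (solve-∀)

  coeff : Poly → ℕ → ℤ
  coeff []      n       = 0ℤ
  coeff (a ∷ p) zero    = a
  coeff (a ∷ p) (suc n) = coeff p n

  infix 4 _≃_

  -- A record rather than a bare Π-type, so that p and q are inferable from p ≃ q.
  record _≃_ (p q : Poly) : Set where
    constructor coeffwise
    field coeff-≡ : ∀ n → coeff p n ≡ coeff q n

  open _≃_ public

  ≃-isEquivalence : IsEquivalence _≃_
  ≃-isEquivalence = record
    { refl  = coeffwise λ _ → refl
    ; sym   = λ p≃q → coeffwise λ n → sym (coeff-≡ p≃q n)
    ; trans = λ p≃q q≃r → coeffwise λ n → trans (coeff-≡ p≃q n) (coeff-≡ q≃r n)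
    }

  ≃-setoid : Setoid _ _
  ≃-setoid = record { isEquivalence = ≃-isEquivalence }

  open IsEquivalence ≃-isEquivalence public
    using () renaming (refl to ≃-refl; sym to ≃-sym; trans to ≃-trans)

  coeff-+ₚ : ∀ p q n → coeff (p +ₚ q) n ≡ coeff p n + coeff q n
  coeff-+ₚ []      q       n       = sym (+-identityˡ _)
  coeff-+ₚ (a ∷ p) []      n       = sym (+-identityʳ _)
  coeff-+ₚ (a ∷ p) (b ∷ q) zero    = refl
  coeff-+ₚ (a ∷ p) (b ∷ q) (suc n) = coeff-+ₚ p q n

  coeff-negₚ : ∀ p n → coeff (-ₚ p) n ≡ - coeff p n
  coeff-negₚ []      n       = refl
  coeff-negₚ (a ∷ p) zero    = refl
  coeff-negₚ (a ∷ p) (suc n) = coeff-negₚ p n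

  coeff-subₚ : ∀ p q n → coeff (p -ₚ q) n ≡ coeff p n - coeff q n
  coeff-subₚ p q n = trans (coeff-+ₚ p (-ₚ q) n) (cong (λ c → coeff p n + c) (coeff-negₚ q n))

  -ₚ-cong : ∀ {p p′ q q′} → p ≃ p′ → q ≃ q′ → p -ₚ q ≃ p′ -ₚ q′
  -ₚ-cong {p} {p′} {q} {q′} p≃p′ q≃q′ = coeffwise λ n → begin
    coeff (p -ₚ q) n          ≡⟨ coeff-subₚ p q n ⟩
    coeff p n - coeff q n     ≡⟨ cong₂ _-_ (coeff-≡ p≃p′ n) (coeff-≡ q≃q′ n) ⟩
    coeff p′ n - coeff q′ n   ≡⟨ coeff-subₚ p′ q′ n ⟨
    coeff (p′ -ₚ q′) n        ∎
    where open ≡-Reasoning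

  IsZeroPoly⇒coeff≡0 : ∀ {p} → IsZeroPoly p → ∀ n → coeff p n ≡ 0ℤ
  IsZeroPoly⇒coeff≡0 []         n       = refl
  IsZeroPoly⇒coeff≡0 (a≡0 ∷ p≡0) zero    = a≡0
  IsZeroPoly⇒coeff≡0 (a≡0 ∷ p≡0) (suc n) = IsZeroPoly⇒coeff≡0 p≡0 n

  coeff≡0⇒IsZeroPoly : ∀ p → (∀ n → coeff p n ≡ 0ℤ) → IsZeroPoly p
  coeff≡0⇒IsZeroPoly []      p≡0 = []
  coeff≡0⇒IsZeroPoly (a ∷ p) p≡0 = p≡0 zero ∷ coeff≡0⇒IsZeroPoly p (p≡0 ∘ suc)

  ≈ₚ⇒≃ : ∀ {p q} → p ≈ₚ q → p ≃ q
  ≈ₚ⇒≃ {p} {q} p≈q = coeffwise λ n →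
    i-j≡0⇒i≡j _ _ (trans (sym (coeff-subₚ p q n)) (IsZeroPoly⇒coeff≡0 p≈q n))

  ≃⇒≈ₚ : ∀ {p q} → p ≃ q → p ≈ₚ q
  ≃⇒≈ₚ {p} {q} p≃q = coeff≡0⇒IsZeroPoly (p -ₚ q) λ n →
    trans (coeff-subₚ p q n) (i≡j⇒i-j≡0 (coeff-≡ p≃q n))

  eval-+ₚ : ∀ p q x → eval (p +ₚ q) x ≡ eval p x + eval q x
  eval-+ₚ []      q       x = sym (+-identityˡ _)
  eval-+ₚ (a ∷ p) []      x = sym (+-identityʳ _)
  eval-+ₚ (a ∷ p) (b ∷ q) x = trans (cong (λ e → a + b + x * e) (eval-+ₚ p q x))
                                    (interchange a b x (eval p x) (eval q x))
    where
    interchange : ∀ a b x u v → a + b + x * (u + v) ≡ a + x * u + (b + x * v)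
    interchange = solve-∀

  eval-negₚ : ∀ p x → eval (-ₚ p) x ≡ - eval p x
  eval-negₚ []      x = refl
  eval-negₚ (a ∷ p) x = trans (cong (λ e → - a + x * e) (eval-negₚ p x)) (negate a x (eval p x))
    where
    negate : ∀ a x u → - a + x * - u ≡ - (a + x * u)
    negate = solve-∀

  eval-IsZeroPoly : ∀ {p} x → IsZeroPoly p → eval p x ≡ 0ℤ
  eval-IsZeroPoly x []          = refl
  eval-IsZeroPoly x (refl ∷ p≡0) =
    trans (+-identityˡ _) (trans (cong (x *_) (eval-IsZeroPoly x p≡0)) (*-zeroʳ x))

  eval-cong : ∀ {p q} x → p ≃ q → eval p x ≡ eval q x
  eval-cong {p} {q} x p≃q = i-j≡0⇒i≡j _ _ (begin
    eval p x - eval q x            ≡⟨ cong (λ e → eval p x + e) (eval-negₚ q x) ⟨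
    eval p x + eval (-ₚ q) x       ≡⟨ eval-+ₚ p (-ₚ q) x ⟨
    eval (p -ₚ q) x                ≡⟨ eval-IsZeroPoly x (≃⇒≈ₚ p≃q) ⟩
    0ℤ                             ∎)
    where open ≡-Reasoning

  constₚ-injective : ∀ {m n} → constₚ (+ m) ≃ constₚ (+ n) → m ≡ n
  constₚ-injective e = +-injective (coeff-≡ e 0)

  linGap-injective : ∀ {m n} → linGap m ≃ linGap n → m ℕ.* m / 4 ≡ n ℕ.* n / 4
  linGap-injective e =
    +-injective (neg-injective (trans (sym (+-identityˡ _)) (trans (coeff-≡ e 0) (+-identityˡ _))))

  constₚ≄linGap : ∀ {c j} → ¬ (constₚ c ≃ linGap j)
  constₚ≄linGap e with coeff-≡ e 1
  ... | ()

open PolynomialEquality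

module EventualInequalities where
  open import Data.Integer
    using (ℤ; 0ℤ; +_; _+_; -_; _-_; _*_; _≤_; _<_; _⊔_; nonNegative) renaming (suc to sucℤ)
  open import Data.Integer.Properties
  open import Data.Integer.Tactic.RingSolver using (solve-∀)
  open import Data.Product.Relation.Binary.Lex.Strict using (×-Lex)
  open import Data.Empty using (⊥-elim)
  open import Relation.Binary.Definitions using (tri<; tri≈; tri>)

  +-cancelˡ-≤ : ∀ i {j k} → i + j ≤ i + k → j ≤ k
  +-cancelˡ-≤ i {j} {k} i+j≤i+k = begin
    j                ≡⟨ cancel i j ⟩
    - i + (i + j)    ≤⟨ +-monoʳ-≤ (- i) i+j≤i+k ⟩
    - i + (i + k)    ≡⟨ cancel i k ⟨
    k                ∎
    where
    open ≤-Reasoning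
    cancel : ∀ i j → j ≡ - i + (i + j)
    cancel = solve-∀

  Eventually : (ℤ → Set) → Set
  Eventually P = ∃[ N ] (∀ x → N ≤ x → P x)

  eventually-∩ : ∀ {P Q} → Eventually P → Eventually Q → Eventually (λ x → P x × Q x)
  eventually-∩ (M , p) (N , q) =
    M ⊔ N , λ x M⊔N≤x → p x (i⊔j≤k⇒i≤k M N M⊔N≤x) , q x (i⊔j≤k⇒j≤k M N M⊔N≤x)

  eventually-mono : ∀ {P Q : ℤ → Set} → (∀ {x} → P x → Q x) → Eventually P → Eventually Q
  eventually-mono P⇒Q (N , p) = N , λ x N≤x → P⇒Q (p x N≤x)

  eventually⇒∃ : ∀ {P} → Eventually P → ∃[ x ] P x
  eventually⇒∃ (N , p) = N , p N ≤-refl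

  eventually-linear-< : ∀ {a c} b d → a < c → Eventually (λ x → a * x + b < c * x + d)
  eventually-linear-< {a} {c} b d a<c =
    eventually-mono bound (eventually-∩ (0ℤ , λ _ → id) (sucℤ (b - d) , λ _ → id))
    where
    open ≤-Reasoning
    bound : ∀ {x} → 0ℤ ≤ x × sucℤ (b - d) ≤ x → a * x + b < c * x + d
    bound {x} (0≤x , b-d<x) = begin-strict
      a * x + b            ≡⟨ cong (λ e → a * x + e) (shift b d) ⟩
      a * x + (b - d + d)  <⟨ +-monoʳ-< (a * x) (+-monoˡ-< d (suc[i]≤j⇒i<j {b - d} b-d<x)) ⟩
      a * x + (x + d)      ≡⟨ regroup a x d ⟩
      sucℤ a * x + d       ≤⟨ +-monoˡ-≤ d (*-monoʳ-≤-nonNeg x {{nonNegative 0≤x}} (i<j⇒suc[i]≤j a<c)) ⟩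
      c * x + d            ∎
      where
      shift : ∀ b d → b ≡ b - d + d
      shift = solve-∀
      regroup : ∀ a x d → a * x + (x + d) ≡ (+ 1 + a) * x + d
      regroup = solve-∀

  eventually-linear-≤⇒lex : ∀ {a b c d} → Eventually (λ x → a * x + b ≤ c * x + d) →
                            ×-Lex _≡_ _<_ _≤_ (a , b) (c , d)
  eventually-linear-≤⇒lex {a} {b} {c} {d} ev with <-cmp a c
  ... | tri< a<c _ _ = inj₁ a<c
  ... | tri≈ _ refl _ =
    let x , ax+b≤ax+d = eventually⇒∃ ev in inj₂ (refl , +-cancelˡ-≤ (a * x) ax+b≤ax+d)
  ... | tri> _ _ c<a =
    let _ , ax+b≤cx+d , cx+d<ax+b = eventually⇒∃ (eventually-∩ ev (eventually-linear-< d b c<a))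
    in ⊥-elim (<⇒≱ cx+d<ax+b ax+b≤cx+d)

  lex⇒eventually-linear-≤ : ∀ {a b c d} → ×-Lex _≡_ _<_ _≤_ (a , b) (c , d) →
                            Eventually (λ x → a * x + b ≤ c * x + d)
  lex⇒eventually-linear-≤ {b = b} {d = d} (inj₁ a<c) = eventually-mono <⇒≤ (eventually-linear-< b d a<c)
  lex⇒eventually-linear-≤ {a} (inj₂ (refl , b≤d))   = 0ℤ , λ x _ → +-monoʳ-≤ (a * x) b≤d

open EventualInequalities

module MonicQuadratics where
  open import Data.Integer using (ℤ; 0ℤ; +_; _+_; -_; _-_; _*_; _≤_; _<_; +≤+; +<+)
  open import Data.Integer.Properties
  open import Data.Integer.Tactic.RingSolver using (solve-∀)
  open import Data.Product.Relation.Binary.Lex.Strict using (×-Lex)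
  open import Data.Empty using (⊥-elim)
  open import Relation.Nullary using (¬_)

  ≤as-resp-≃ : ∀ {f f′ g g′} → f ≃ f′ → g ≃ g′ → f ≤as g → f′ ≤as g′
  ≤as-resp-≃ f≃f′ g≃g′ = eventually-mono λ {x} → subst₂ _≤_ (eval-cong x f≃f′) (eval-cong x g≃g′)

  <as-resp-≃ : ∀ {f f′ g g′} → f ≃ f′ → g ≃ g′ → f <as g → f′ <as g′
  <as-resp-≃ f≃f′ g≃g′ (f≤g , f≉g) =
    ≤as-resp-≃ f≃f′ g≃g′ f≤g ,
    λ f′≈g′ → f≉g (≃⇒≈ₚ (≃-trans f≃f′ (≃-trans (≈ₚ⇒≃ f′≈g′) (≃-sym g≃g′))))

  X²-_X+_ : ℕ → ℕ → Poly
  X²- s X+ p = + p ∷ - + s ∷ + 1 ∷ []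

  eval-X²-X+ : ∀ s p x → eval (X²- s X+ p) x ≡ x * x + (- + s * x + + p)
  eval-X²-X+ s p x = expand (+ p) (- + s) x
    where
    expand : ∀ p c x → p + x * (c + x * (+ 1 + x * 0ℤ)) ≡ x * x + (c * x + p)
    expand = solve-∀

  X²-X+-≤as⇒lex : ∀ {s p t q} → X²- s X+ p ≤as X²- t X+ q → ×-Lex _≡_ ℕ._>_ ℕ._≤_ (s , p) (t , q)
  X²-X+-≤as⇒lex {s} {p} {t} {q} = fromℤ ∘ eventually-linear-≤⇒lex ∘ eventually-mono linear
    where
    linear : ∀ {x} → eval (X²- s X+ p) x ≤ eval (X²- t X+ q) x → - + s * x + + p ≤ - + t * x + + q
    linear {x} = +-cancelˡ-≤ (x * x) ∘ subst₂ _≤_ (eval-X²-X+ s p x) (eval-X²-X+ t q x)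
    fromℤ : ×-Lex _≡_ _<_ _≤_ (- + s , + p) (- + t , + q) → ×-Lex _≡_ ℕ._>_ ℕ._≤_ (s , p) (t , q)
    fromℤ (inj₁ -s<-t)           = inj₁ (drop‿+<+ (neg-cancel-< -s<-t))
    fromℤ (inj₂ (-s≡-t , +p≤+q)) = inj₂ (+-injective (neg-injective -s≡-t) , drop‿+≤+ +p≤+q)

  lex⇒X²-X+-≤as : ∀ {s p t q} → ×-Lex _≡_ ℕ._>_ ℕ._≤_ (s , p) (t , q) → X²- s X+ p ≤as X²- t X+ q
  lex⇒X²-X+-≤as {s} {p} {t} {q} = eventually-mono quadratic ∘ lex⇒eventually-linear-≤ ∘ toℤ
    where
    toℤ : ×-Lex _≡_ ℕ._>_ ℕ._≤_ (s , p) (t , q) → ×-Lex _≡_ _<_ _≤_ (- + s , + p) (- + t , + q)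
    toℤ (inj₁ t<s)          = inj₁ (neg-mono-< (+<+ t<s))
    toℤ (inj₂ (refl , p≤q)) = inj₂ (refl , +≤+ p≤q)
    quadratic : ∀ {x} → - + s * x + + p ≤ - + t * x + + q → eval (X²- s X+ p) x ≤ eval (X²- t X+ q) x
    quadratic {x} = subst₂ _≤_ (sym (eval-X²-X+ s p x)) (sym (eval-X²-X+ t q x)) ∘ +-monoʳ-≤ (x * x)

  X²-X+-injective : ∀ {s p t q} → X²- s X+ p ≃ X²- t X+ q → s ≡ t × p ≡ q
  X²-X+-injective e = +-injective (neg-injective (coeff-≡ e 1)) , +-injective (coeff-≡ e 0)

  X²-X+-<as⇒lex : ∀ {s p t q} → X²- s X+ p <as X²- t X+ q → ×-Lex _≡_ ℕ._>_ ℕ._<_ (s , p) (t , q)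
  X²-X+-<as⇒lex {s} {p} (s,p≤t,q , ≉) with X²-X+-≤as⇒lex s,p≤t,q
  ... | inj₁ t<s           = inj₁ t<s
  ... | inj₂ (refl , p≤q) with ℕₚ.m≤n⇒m<n∨m≡n p≤q
  ...   | inj₁ p<q  = inj₂ (refl , p<q)
  ...   | inj₂ refl = ⊥-elim (≉ (≃⇒≈ₚ (≃-refl {X²- s X+ p})))

  lex⇒X²-X+-<as : ∀ {s p t q} → ×-Lex _≡_ ℕ._>_ ℕ._<_ (s , p) (t , q) → X²- s X+ p <as X²- t X+ q
  lex⇒X²-X+-<as s,p<t,q =
    lex⇒X²-X+-≤as (weaken s,p<t,q) , irreflexive s,p<t,q ∘ X²-X+-injective ∘ ≈ₚ⇒≃
    where
    weaken : ∀ {s p t q} → ×-Lex _≡_ ℕ._>_ ℕ._<_ (s , p) (t , q) →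
             ×-Lex _≡_ ℕ._>_ ℕ._≤_ (s , p) (t , q)
    weaken (inj₁ t<s)         = inj₁ t<s
    weaken (inj₂ (s≡t , p<q)) = inj₂ (s≡t , ℕₚ.<⇒≤ p<q)
    irreflexive : ∀ {s p t q} → ×-Lex _≡_ ℕ._>_ ℕ._<_ (s , p) (t , q) → ¬ (s ≡ t × p ≡ q)
    irreflexive (inj₁ t<s)       (refl , _) = ℕₚ.<-irrefl refl t<s
    irreflexive (inj₂ (_ , p<q)) (_ , refl) = ℕₚ.<-irrefl refl p<q

  pab≃X²-X+ : ∀ a b → pab a b ≃ X²- (a ℕ.+ b) X+ (a ℕ.* b)
  pab≃X²-X+ a b = coeffwise λ where
      0                   → trans (vieta-product (+ a) (+ b)) (sym (pos-* a b))
      1                   → trans (vieta-sum (+ a) (+ b)) (cong -_ (sym (pos-+ a b)))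
      2                   → refl
      (suc (suc (suc _))) → refl
    where
    vieta-product : ∀ a b → (0ℤ + - a) * (0ℤ + - b) + 0ℤ ≡ a * b
    vieta-product = solve-∀
    vieta-sum : ∀ a b → (0ℤ + - a) * + 1 + (+ 1 * (0ℤ + - b) + 0ℤ) ≡ - (a + b)
    vieta-sum = solve-∀

  X²-X+-sub-same-sum : ∀ s p k → X²- s X+ (p ℕ.+ k) -ₚ X²- s X+ p ≃ constₚ (+ k)
  X²-X+-sub-same-sum s p k = coeffwise λ where
      0                   → trans (cong (_- + p) (pos-+ p k)) (cancel (+ p) (+ k))
      1                   → +-inverseʳ (- + s)
      2                   → refl
      (suc (suc (suc _))) → refl
    where
    cancel : ∀ p k → p + k - p ≡ k
    cancel = solve-∀

  X²-X+-sub-next-sum : ∀ s p → X²- s X+ 0 -ₚ X²- suc s X+ p ≃ Xₚ -ₚ constₚ (+ p)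
  X²-X+-sub-next-sum s p = coeffwise λ where
      0                   → refl
      1                   → slope (+ s)
      2                   → refl
      (suc (suc (suc _))) → refl
    where
    slope : ∀ s → - s + - - (+ 1 + s) ≡ + 1
    slope = solve-∀

open MonicQuadratics

module QuarterSquares where
  open import Data.Nat using (_+_; _*_; _∸_; _≤_; _<_; ⌊_/2⌋; ⌈_/2⌉; z≤n; s≤s)
  open import Data.Nat.Properties
  open import Data.Nat.DivMod using (_/_; m*n/n≡m; +-distrib-/-∣ʳ)
  open import Data.Nat.Divisibility using (divides)
  open import Data.Nat.Tactic.RingSolver using (solve-∀)
  open import Relation.Binary.Definitions using (tri<; tri≈; tri>)
  open import Data.Empty using (⊥-elim)

  ⌊n/2⌋*⌈n/2⌉≡n*n/4 : ∀ n → ⌊ n /2⌋ * ⌈ n /2⌉ ≡ n * n / 4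
  ⌊n/2⌋*⌈n/2⌉≡n*n/4 0             = refl
  ⌊n/2⌋*⌈n/2⌉≡n*n/4 1             = refl
  ⌊n/2⌋*⌈n/2⌉≡n*n/4 (suc (suc n)) = begin
    suc ⌊ n /2⌋ * suc ⌈ n /2⌉                    ≡⟨ expand ⌊ n /2⌋ ⌈ n /2⌉ ⟩
    ⌊ n /2⌋ * ⌈ n /2⌉ + suc (⌊ n /2⌋ + ⌈ n /2⌉)  ≡⟨ cong₂ _+_ (⌊n/2⌋*⌈n/2⌉≡n*n/4 n)
                                                            (cong suc (⌊n/2⌋+⌈n/2⌉≡n n)) ⟩
    n * n / 4 + suc n                            ≡⟨ cong (n * n / 4 +_) (m*n/n≡m (suc n) 4) ⟨
    n * n / 4 + suc n * 4 / 4                    ≡⟨ +-distrib-/-∣ʳ (n * n) (divides (suc n) refl) ⟨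
    (n * n + suc n * 4) / 4                      ≡⟨ cong (_/ 4) (square n) ⟩
    suc (suc n) * suc (suc n) / 4                ∎
    where
    open ≡-Reasoning
    expand : ∀ a b → suc a * suc b ≡ a * b + suc (a + b)
    expand = solve-∀
    square : ∀ n → n * n + suc n * 4 ≡ suc (suc n) * suc (suc n)
    square = solve-∀

  ⌊n/2⌋*⌈n/2⌉-step : ∀ {n} → 1 ≤ n → ⌊ n /2⌋ * ⌈ n /2⌉ < ⌊ suc n /2⌋ * ⌈ suc n /2⌉
  ⌊n/2⌋*⌈n/2⌉-step {suc n} _ =
    subst (⌈ n /2⌉ * suc ⌊ n /2⌋ <_) (grow ⌊ n /2⌋ ⌈ n /2⌉) (m<m+n _ (s≤s z≤n))
    where
    grow : ∀ a b → b * suc a + suc a ≡ suc a * suc b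
    grow = solve-∀

  ⌊n/2⌋*⌈n/2⌉-strictMono : ∀ {m n} → 1 ≤ m → m < n → ⌊ m /2⌋ * ⌈ m /2⌉ < ⌊ n /2⌋ * ⌈ n /2⌉
  ⌊n/2⌋*⌈n/2⌉-strictMono {m} {suc n} 1≤m (s≤s m≤n) with m≤n⇒m<n∨m≡n m≤n
  ... | inj₁ m<n  =
    <-trans (⌊n/2⌋*⌈n/2⌉-strictMono 1≤m m<n) (⌊n/2⌋*⌈n/2⌉-step (≤-trans 1≤m (<⇒≤ m<n)))
  ... | inj₂ refl = ⌊n/2⌋*⌈n/2⌉-step 1≤m

  n*n/4-strictMono : ∀ {m n} → 1 ≤ m → m < n → m * m / 4 < n * n / 4
  n*n/4-strictMono {m} {n} 1≤m m<n =
    subst₂ _<_ (⌊n/2⌋*⌈n/2⌉≡n*n/4 m) (⌊n/2⌋*⌈n/2⌉≡n*n/4 n) (⌊n/2⌋*⌈n/2⌉-strictMono 1≤m m<n)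

  n*n/4-injective : ∀ {m n} → 1 ≤ m → 1 ≤ n → m * m / 4 ≡ n * n / 4 → m ≡ n
  n*n/4-injective {m} {n} 1≤m 1≤n m²/4≡n²/4 with <-cmp m n
  ... | tri< m<n _ _ = ⊥-elim (<-irrefl m²/4≡n²/4 (n*n/4-strictMono 1≤m m<n))
  ... | tri≈ _ m≡n _ = m≡n
  ... | tri> _ _ n<m = ⊥-elim (<-irrefl (sym m²/4≡n²/4) (n*n/4-strictMono 1≤n n<m))

  n∸⌊n/2⌋≡⌈n/2⌉ : ∀ n → n ∸ ⌊ n /2⌋ ≡ ⌈ n /2⌉
  n∸⌊n/2⌋≡⌈n/2⌉ n = trans (cong (_∸ ⌊ n /2⌋) (sym (⌊n/2⌋+⌈n/2⌉≡n n))) (m+n∸m≡n ⌊ n /2⌋ ⌈ n /2⌉)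

open QuarterSquares

module IndexedElements where
  open import Data.Nat using (_+_; _*_; _≤_; _<_; _>_; _∸_; ⌊_/2⌋; ⌈_/2⌉; z≤n; s≤s; _≤?_)
  open import Data.Nat.DivMod using (_/_)
  open import Data.Nat.Properties
  open import Data.Nat.Tactic.RingSolver using (solve-∀)
  open import Data.Integer using (+_)
  open import Data.Product.Relation.Binary.Lex.Strict using (×-Lex)
  open import Relation.Binary.Definitions using (tri<; tri≈; tri>)
  open import Relation.Nullary using (¬_; yes; no)
  open import Data.Empty using (⊥-elim)
  import Relation.Binary.Reasoning.Setoid as SetoidReasoning

  ⟦_⟧ : ℕ × ℕ → Poly
  ⟦ s , a ⟧ = pab a (s ∸ a)

  Valid : ℕ × ℕ → Set
  Valid (s , a) = a ≤ ⌊ s /2⌋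

  valid⇒≤ : ∀ {s a} → Valid (s , a) → a ≤ s
  valid⇒≤ {s} a≤⌊s/2⌋ = ≤-trans a≤⌊s/2⌋ (⌊n/2⌋≤n s)

  valid⇒≤∸ : ∀ {s a} → Valid (s , a) → a ≤ s ∸ a
  valid⇒≤∸ {s} {a} a≤⌊s/2⌋ = begin
    a              ≤⟨ a≤⌊s/2⌋ ⟩
    ⌊ s /2⌋        ≤⟨ ⌊n/2⌋≤⌈n/2⌉ s ⟩
    ⌈ s /2⌉        ≡⟨ n∸⌊n/2⌋≡⌈n/2⌉ s ⟨
    s ∸ ⌊ s /2⌋    ≤⟨ ∸-monoʳ-≤ s a≤⌊s/2⌋ ⟩
    s ∸ a          ∎
    where open ≤-Reasoning

  ≤⇒valid : ∀ {a b} → a ≤ b → Valid (a + b , a)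
  ≤⇒valid {a} a≤b = ≤-trans (≤-reflexive (n≡⌊n+n/2⌋ a)) (⌊n/2⌋-mono (+-monoʳ-≤ a a≤b))

  Inℙ⇒valid : ∀ {f} → Inℙ f → ∃[ x ] (Valid x × f ≃ ⟦ x ⟧)
  Inℙ⇒valid {f} (a , b , a≤b , f≈pab) =
    (a + b , a) , ≤⇒valid a≤b , ≈ₚ⇒≃ (subst (λ c → f ≈ₚ pab a c) (sym (m+n∸m≡n a b)) f≈pab)

  valid⇒Inℙ : ∀ {f x} → Valid x → f ≃ ⟦ x ⟧ → Inℙ f
  valid⇒Inℙ {x = s , a} valid f≃x = a , s ∸ a , valid⇒≤∸ valid , ≃⇒≈ₚ f≃x

  ⟦⟧≃X²-X+ : ∀ {s a} → a ≤ s → ⟦ s , a ⟧ ≃ X²- s X+ (a * (s ∸ a))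
  ⟦⟧≃X²-X+ {s} {a} a≤s =
    subst (λ t → ⟦ s , a ⟧ ≃ X²- t X+ (a * (s ∸ a))) (m+[n∸m]≡n a≤s) (pab≃X²-X+ a (s ∸ a))

  ≃⟦⟧⇒≃X²-X+ : ∀ {f s a} → Valid (s , a) → f ≃ ⟦ s , a ⟧ → f ≃ X²- s X+ (a * (s ∸ a))
  ≃⟦⟧⇒≃X²-X+ valid f≃x = ≃-trans f≃x (⟦⟧≃X²-X+ (valid⇒≤ valid))

  1+a≤⌊s/2⌋⇒2a+1+k≡s : ∀ {s a} → suc a ≤ ⌊ s /2⌋ → ∃[ k ] (1 ≤ k × 2 * a + 1 + k ≡ s)
  1+a≤⌊s/2⌋⇒2a+1+k≡s {s} {a} 1+a≤⌊s/2⌋ =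
    let o , 2+2a+o≡s = m≤n⇒∃[o]m+o≡n 2+2a≤s in suc o , s≤s z≤n , trans (regroup a o) 2+2a+o≡s
    where
    2+2a≤s : suc a + suc a ≤ s
    2+2a≤s = begin
      suc a + suc a       ≤⟨ +-mono-≤ 1+a≤⌊s/2⌋ (≤-trans 1+a≤⌊s/2⌋ (⌊n/2⌋≤⌈n/2⌉ s)) ⟩
      ⌊ s /2⌋ + ⌈ s /2⌉   ≡⟨ ⌊n/2⌋+⌈n/2⌉≡n s ⟩
      s                   ∎
      where open ≤-Reasoning
    regroup : ∀ a o → 2 * a + 1 + suc o ≡ suc a + suc a + o
    regroup = solve-∀

  2a+1+k≡s⇒1+a≤⌊s/2⌋ : ∀ {s a k} → 1 ≤ k → 2 * a + 1 + k ≡ s → suc a ≤ ⌊ s /2⌋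
  2a+1+k≡s⇒1+a≤⌊s/2⌋ {s} {a} {suc o} _ refl = begin
    suc a                          ≡⟨ n≡⌊n+n/2⌋ (suc a) ⟩
    ⌊ suc a + suc a /2⌋            ≤⟨ ⌊n/2⌋-mono (m≤m+n (suc a + suc a) o) ⟩
    ⌊ suc a + suc a + o /2⌋        ≡⟨ cong ⌊_/2⌋ (regroup a o) ⟨
    ⌊ 2 * a + 1 + suc o /2⌋        ∎
    where
    open ≤-Reasoning
    regroup : ∀ a o → 2 * a + 1 + suc o ≡ suc a + suc a + o
    regroup = solve-∀

  *-∸-step : ∀ {s a k} → 2 * a + 1 + k ≡ s → suc a * (s ∸ suc a) ≡ a * (s ∸ a) + k
  *-∸-step {a = a} {k} refl = begin
    suc a * (2 * a + 1 + k ∸ suc a)      ≡⟨ cong (λ s → suc a * (s ∸ suc a)) (split₁ a k) ⟩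
    suc a * (suc a + (a + k) ∸ suc a)    ≡⟨ cong (suc a *_) (m+n∸m≡n (suc a) (a + k)) ⟩
    suc a * (a + k)                      ≡⟨ expand a k ⟩
    a * suc (a + k) + k                  ≡⟨ cong (λ c → a * c + k) (m+n∸m≡n a (suc (a + k))) ⟨
    a * (a + suc (a + k) ∸ a) + k        ≡⟨ cong (λ s → a * (s ∸ a) + k) (split₀ a k) ⟨
    a * (2 * a + 1 + k ∸ a) + k          ∎
    where
    open ≡-Reasoning
    split₀ : ∀ a k → 2 * a + 1 + k ≡ a + suc (a + k)
    split₀ = solve-∀
    split₁ : ∀ a k → 2 * a + 1 + k ≡ suc a + (a + k)
    split₁ = solve-∀
    expand : ∀ a k → suc a * (a + k) ≡ a * suc (a + k) + k
    expand = solve-∀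

  *-∸-step-< : ∀ {s a} → suc a ≤ ⌊ s /2⌋ → a * (s ∸ a) < suc a * (s ∸ suc a)
  *-∸-step-< {s} {a} 1+a≤⌊s/2⌋ with 1+a≤⌊s/2⌋⇒2a+1+k≡s 1+a≤⌊s/2⌋
  ... | k , 1≤k , gap = subst (a * (s ∸ a) <_) (sym (*-∸-step gap)) (m<m+n _ 1≤k)

  *-∸-strictMono : ∀ {s a c} → a < c → c ≤ ⌊ s /2⌋ → a * (s ∸ a) < c * (s ∸ c)
  *-∸-strictMono {c = suc c} (s≤s a≤c) 1+c≤⌊s/2⌋ with m≤n⇒m<n∨m≡n a≤c
  ... | inj₁ a<c  =
    <-trans (*-∸-strictMono a<c (≤-trans (n≤1+n c) 1+c≤⌊s/2⌋)) (*-∸-step-< 1+c≤⌊s/2⌋)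
  ... | inj₂ refl = *-∸-step-< 1+c≤⌊s/2⌋

  *-∸-cancel-< : ∀ {s a c} → a ≤ ⌊ s /2⌋ → a * (s ∸ a) < c * (s ∸ c) → a < c
  *-∸-cancel-< {s} {a} {c} a≤⌊s/2⌋ lt with <-cmp a c
  ... | tri< a<c _ _ = a<c
  ... | tri≈ _ refl _ = ⊥-elim (<-irrefl refl lt)
  ... | tri> _ _ c<a = ⊥-elim (<-asym lt (*-∸-strictMono c<a a≤⌊s/2⌋))

  infix 4 _⊏_ _⋖_

  _⊏_ : ℕ × ℕ → ℕ × ℕ → Set
  _⊏_ = ×-Lex _≡_ _>_ _<_

  <as⇒⊏ : ∀ {f g x y} → Valid x → Valid y → f ≃ ⟦ x ⟧ → g ≃ ⟦ y ⟧ → f <as g → x ⊏ y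
  <as⇒⊏ {x = s , a} {t , c} va vc f≃x g≃y f<g
    with X²-X+-<as⇒lex (<as-resp-≃ (≃⟦⟧⇒≃X²-X+ va f≃x) (≃⟦⟧⇒≃X²-X+ vc g≃y) f<g)
  ... | inj₁ t<s          = inj₁ t<s
  ... | inj₂ (refl , p<q) = inj₂ (refl , *-∸-cancel-< va p<q)

  ⊏⇒<as : ∀ {f g x y} → Valid x → Valid y → f ≃ ⟦ x ⟧ → g ≃ ⟦ y ⟧ → x ⊏ y → f <as g
  ⊏⇒<as {x = s , a} {t , c} va vc f≃x g≃y x⊏y =
    <as-resp-≃ (≃-sym (≃⟦⟧⇒≃X²-X+ va f≃x)) (≃-sym (≃⟦⟧⇒≃X²-X+ vc g≃y)) (lex⇒X²-X+-<as (constant-terms x⊏y))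
    where
    constant-terms : (s , a) ⊏ (t , c) → ×-Lex _≡_ _>_ _<_ (s , a * (s ∸ a)) (t , c * (t ∸ c))
    constant-terms (inj₁ t<s)          = inj₁ t<s
    constant-terms (inj₂ (refl , a<c)) = inj₂ (refl , *-∸-strictMono a<c vc)

  data _⋖_ : ℕ × ℕ → ℕ × ℕ → Set where
    inward  : ∀ {s a k} → 1 ≤ k → 2 * a + 1 + k ≡ s → (s , a) ⋖ (s , suc a)
    descend : ∀ s → (suc s , ⌊ suc s /2⌋) ⋖ (s , 0)

  ⋖-valid : ∀ {x y} → x ⋖ y → Valid x × Valid y
  ⋖-valid (inward {s} {a} 1≤k 2a+1+k≡s) = ≤-trans (n≤1+n a) 1+a≤⌊s/2⌋ , 1+a≤⌊s/2⌋
    where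
    1+a≤⌊s/2⌋ : suc a ≤ ⌊ s /2⌋
    1+a≤⌊s/2⌋ = 2a+1+k≡s⇒1+a≤⌊s/2⌋ 1≤k 2a+1+k≡s
  ⋖-valid (descend s) = ≤-refl , z≤n

  ⋖⇒⊏ : ∀ {x y} → x ⋖ y → x ⊏ y
  ⋖⇒⊏ (inward {a = a} _ _) = inj₂ (refl , n<1+n a)
  ⋖⇒⊏ (descend s)        = inj₁ (n<1+n s)

  ⋖-nothing-between : ∀ {x y z} → x ⋖ y → Valid z → x ⊏ z → ¬ z ⊏ y
  ⋖-nothing-between (inward _ _) _   (inj₁ t<s)        (inj₁ s<t)          = <-asym t<s s<t
  ⋖-nothing-between (inward _ _) _   (inj₁ t<s)        (inj₂ (refl , _))   = <-irrefl refl t<s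
  ⋖-nothing-between (inward _ _) _   (inj₂ (refl , _)) (inj₁ s<s)          = <-irrefl refl s<s
  ⋖-nothing-between (inward _ _) _   (inj₂ (_ , a<e))  (inj₂ (_ , e<1+a))  = <⇒≱ a<e (≤-pred e<1+a)
  ⋖-nothing-between (descend s) _   (inj₁ t<1+s)      (inj₁ s<t)          = <⇒≱ s<t (≤-pred t<1+s)
  ⋖-nothing-between (descend s) e≤h (inj₂ (refl , h<e)) (inj₁ _)          = <⇒≱ h<e e≤h

  covering⇒⋖ : ∀ {x y} → Valid x → Valid y → x ⊏ y → (∀ z → Valid z → x ⊏ z → ¬ z ⊏ y) → x ⋖ y
  covering⇒⋖ {s , a} _ vc (inj₂ (refl , a<c)) nothing with m≤n⇒m<n∨m≡n a<c
  ... | inj₁ 1+a<c =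
    ⊥-elim (nothing (s , suc a) (≤-trans (<⇒≤ 1+a<c) vc) (inj₂ (refl , n<1+n a)) (inj₂ (refl , 1+a<c)))
  ... | inj₂ refl  = let _ , 1≤k , 2a+1+k≡s = 1+a≤⌊s/2⌋⇒2a+1+k≡s vc in inward 1≤k 2a+1+k≡s
  covering⇒⋖ {s , a} {t , c} va _ (inj₁ t<s) nothing with m≤n⇒m<n∨m≡n t<s
  ... | inj₁ 1+t<s = ⊥-elim (nothing (suc t , 0) z≤n (inj₁ 1+t<s) (inj₁ (n<1+n t)))
  ... | inj₂ refl with c | suc a ≤? ⌊ s /2⌋
  ...   | suc _ | _         = ⊥-elim (nothing (t , 0) z≤n (inj₁ t<s) (inj₂ (refl , s≤s z≤n)))
  ...   | zero  | yes 1+a≤h = ⊥-elim (nothing (s , suc a) 1+a≤h (inj₂ (refl , n<1+n a)) (inj₁ t<s))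
  ...   | zero  | no 1+a≰h with ≤-antisym va (≤-pred (≰⇒> 1+a≰h))
  ...     | refl = descend t

  PrimGapPair⇒⋖ : ∀ {f g} → PrimGapPair f g → ∃[ x ] ∃[ y ] (x ⋖ y × f ≃ ⟦ x ⟧ × g ≃ ⟦ y ⟧)
  PrimGapPair⇒⋖ (f∈𝒫 , g∈𝒫 , f<g , nothing-between) with Inℙ⇒valid f∈𝒫 | Inℙ⇒valid g∈𝒫
  ... | x , vx , f≃x | y , vy , g≃y =
    x , y , covering⇒⋖ vx vy (<as⇒⊏ vx vy f≃x g≃y f<g) between , f≃x , g≃y
    where
    between : ∀ z → Valid z → x ⊏ z → ¬ z ⊏ y
    between z vz x⊏z z⊏y = nothing-between ⟦ z ⟧ (valid⇒Inℙ vz ≃-refl)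
      (⊏⇒<as vx vz f≃x ≃-refl x⊏z , ⊏⇒<as vz vy ≃-refl g≃y z⊏y)

  ⋖⇒PrimGapPair : ∀ {f g x y} → x ⋖ y → f ≃ ⟦ x ⟧ → g ≃ ⟦ y ⟧ → PrimGapPair f g
  ⋖⇒PrimGapPair {f} {g} {x} {y} x⋖y f≃x g≃y =
    valid⇒Inℙ vx f≃x , valid⇒Inℙ vy g≃y , ⊏⇒<as vx vy f≃x g≃y (⋖⇒⊏ x⋖y) , between
    where
    vx : Valid x
    vx = proj₁ (⋖-valid x⋖y)
    vy : Valid y
    vy = proj₂ (⋖-valid x⋖y)
    between : ∀ h → Inℙ h → ¬ (f <as h × h <as g)
    between h h∈𝒫 (f<h , h<g) with Inℙ⇒valid h∈𝒫
    ... | z , vz , h≃z =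
      ⋖-nothing-between x⋖y vz (<as⇒⊏ vx vz f≃x h≃z f<h) (<as⇒⊏ vz vy h≃z g≃y h<g)

  2a+1+k≡1+a+[a+k] : ∀ a k → 2 * a + 1 + k ≡ suc a + (a + k)
  2a+1+k≡1+a+[a+k] = solve-∀

  gap-inward : ∀ {s a k} → 2 * a + 1 + k ≡ s → ⟦ s , suc a ⟧ -ₚ ⟦ s , a ⟧ ≃ constₚ (+ k)
  gap-inward {s} {a} {k} 2a+1+k≡s = begin
    ⟦ s , suc a ⟧ -ₚ ⟦ s , a ⟧                    ≈⟨ -ₚ-cong (⟦⟧≃X²-X+ 1+a≤s) (⟦⟧≃X²-X+ (<⇒≤ 1+a≤s)) ⟩
    X²- s X+ (suc a * (s ∸ suc a)) -ₚ X²- s X+ p  ≡⟨ cong (λ q → X²- s X+ q -ₚ X²- s X+ p) (*-∸-step 2a+1+k≡s) ⟩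
    X²- s X+ (p + k) -ₚ X²- s X+ p                ≈⟨ X²-X+-sub-same-sum s p k ⟩
    constₚ (+ k)                                  ∎
    where
    open SetoidReasoning ≃-setoid
    p : ℕ
    p = a * (s ∸ a)
    1+a≤s : suc a ≤ s
    1+a≤s = subst (suc a ≤_) (trans (sym (2a+1+k≡1+a+[a+k] a k)) 2a+1+k≡s) (m≤m+n (suc a) (a + k))

  gap-descend : ∀ s → ⟦ s , 0 ⟧ -ₚ ⟦ suc s , ⌊ suc s /2⌋ ⟧ ≃ linGap (suc s)
  gap-descend s = begin
    ⟦ s , 0 ⟧ -ₚ ⟦ suc s , h ⟧                    ≈⟨ -ₚ-cong (⟦⟧≃X²-X+ {s} z≤n) (⟦⟧≃X²-X+ (⌊n/2⌋≤n (suc s))) ⟩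
    X²- s X+ 0 -ₚ X²- suc s X+ (h * (suc s ∸ h))  ≈⟨ X²-X+-sub-next-sum s (h * (suc s ∸ h)) ⟩
    Xₚ -ₚ constₚ (+ (h * (suc s ∸ h)))            ≡⟨ cong (λ c → Xₚ -ₚ constₚ (+ c)) quarter-square ⟩
    linGap (suc s)                                ∎
    where
    open SetoidReasoning ≃-setoid
    h : ℕ
    h = ⌊ suc s /2⌋
    quarter-square : h * (suc s ∸ h) ≡ suc s * suc s / 4
    quarter-square = trans (cong (h *_) (n∸⌊n/2⌋≡⌈n/2⌉ (suc s))) (⌊n/2⌋*⌈n/2⌉≡n*n/4 (suc s))

  ⟦s,1+a⟧≡pab : ∀ s a → ⟦ s , suc a ⟧ ≡ pab (a + 1) (s ∸ a ∸ 1)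
  ⟦s,1+a⟧≡pab s a =
    cong₂ pab (+-comm 1 a) (trans (cong (s ∸_) (+-comm 1 a)) (sym (∸-+-assoc s a 1)))

open IndexedElements
open import Data.Nat using (_≤_; _+_; _*_; _∸_; ⌊_/2⌋; z≤n; s≤s)
open import Data.Nat.Properties using (suc-injective)
open import Data.Integer using (+_)
open import Data.Empty using (⊥-elim)

primitive-gap-shape : ∀ d → IsPrimitiveGap d →
  (∃[ k ] (1 ≤ k × d ≈ₚ constₚ (+ k))) ⊎ (∃[ j ] (1 ≤ j × d ≈ₚ linGap j))
primitive-gap-shape d (f , g , pair , d≈g-f) =
  let _ , _ , x⋖y , f≃x , g≃y = PrimGapPair⇒⋖ pair
  in shape x⋖y (≃-trans (≈ₚ⇒≃ d≈g-f) (-ₚ-cong g≃y f≃x))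
  where
  shape : ∀ {x y} → x ⋖ y → d ≃ ⟦ y ⟧ -ₚ ⟦ x ⟧ →
          (∃[ k ] (1 ≤ k × d ≈ₚ constₚ (+ k))) ⊎ (∃[ j ] (1 ≤ j × d ≈ₚ linGap j))
  shape (inward 1≤k 2a+1+k≡s) d≃y-x = inj₁ (_ , 1≤k , ≃⇒≈ₚ (≃-trans d≃y-x (gap-inward 2a+1+k≡s)))
  shape (descend s)          d≃y-x = inj₂ (suc s , s≤s z≤n , ≃⇒≈ₚ (≃-trans d≃y-x (gap-descend s)))

linear-gap-occurs-once : ∀ j → 1 ≤ j →
  ∃[ f ] ∃[ g ] ((PrimGapPair f g × (g -ₚ f) ≈ₚ linGap j)
    × (∀ f′ g′ → PrimGapPair f′ g′ → (g′ -ₚ f′) ≈ₚ linGap j → (f′ ≈ₚ f) × (g′ ≈ₚ g)))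
linear-gap-occurs-once (suc s) _ =
  ⟦ suc s , ⌊ suc s /2⌋ ⟧ , ⟦ s , 0 ⟧ ,
  (⋖⇒PrimGapPair (descend s) ≃-refl ≃-refl , ≃⇒≈ₚ (gap-descend s)) ,
  λ f′ g′ pair g′-f′≈linGap →
    let _ , _ , x⋖y , f′≃x , g′≃y = PrimGapPair⇒⋖ pair
    in unique x⋖y f′≃x g′≃y (≃-trans (≃-sym (-ₚ-cong g′≃y f′≃x)) (≈ₚ⇒≃ g′-f′≈linGap))
  where
  unique : ∀ {f′ g′ x y} → x ⋖ y → f′ ≃ ⟦ x ⟧ → g′ ≃ ⟦ y ⟧ → ⟦ y ⟧ -ₚ ⟦ x ⟧ ≃ linGap (suc s) →
           (f′ ≈ₚ ⟦ suc s , ⌊ suc s /2⌋ ⟧) × (g′ ≈ₚ ⟦ s , 0 ⟧)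
  unique (inward _ 2a+1+k≡s) _ _ y-x≃linGap =
    ⊥-elim (constₚ≄linGap {j = suc s} (≃-trans (≃-sym (gap-inward 2a+1+k≡s)) y-x≃linGap))
  unique {f′} {g′} (descend s′) f′≃x g′≃y y-x≃linGap =
    subst (λ t → (f′ ≈ₚ ⟦ suc t , ⌊ suc t /2⌋ ⟧) × (g′ ≈ₚ ⟦ t , 0 ⟧)) s′≡s (≃⇒≈ₚ f′≃x , ≃⇒≈ₚ g′≃y)
    where
    s′≡s : s′ ≡ s
    s′≡s = suc-injective (n*n/4-injective (s≤s z≤n) (s≤s z≤n)
             (linGap-injective {suc s′} {suc s} (≃-trans (≃-sym (gap-descend s′)) y-x≃linGap)))

constant-gap-pairs : ∀ k → 1 ≤ k → ∀ f g →
  ((PrimGapPair f g × (g -ₚ f) ≈ₚ constₚ (+ k)) →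
    ∃[ a ] ∃[ j ] ((2 * a + 1 + k ≡ j) × (f ≈ₚ pab a (j ∸ a)) × (g ≈ₚ pab (a + 1) (j ∸ a ∸ 1))))
  × (∀ a j → 2 * a + 1 + k ≡ j → f ≈ₚ pab a (j ∸ a) → g ≈ₚ pab (a + 1) (j ∸ a ∸ 1) →
      PrimGapPair f g × (g -ₚ f) ≈ₚ constₚ (+ k))
constant-gap-pairs k 1≤k f g = from-pair , to-pair
  where
  from-pair : PrimGapPair f g × (g -ₚ f) ≈ₚ constₚ (+ k) →
    ∃[ a ] ∃[ j ] ((2 * a + 1 + k ≡ j) × (f ≈ₚ pab a (j ∸ a)) × (g ≈ₚ pab (a + 1) (j ∸ a ∸ 1)))
  from-pair (pair , g-f≈k) =
    let _ , _ , x⋖y , f≃x , g≃y = PrimGapPair⇒⋖ pair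
    in indices x⋖y f≃x g≃y (≃-trans (≃-sym (-ₚ-cong g≃y f≃x)) (≈ₚ⇒≃ g-f≈k))
    where
    indices : ∀ {x y} → x ⋖ y → f ≃ ⟦ x ⟧ → g ≃ ⟦ y ⟧ → ⟦ y ⟧ -ₚ ⟦ x ⟧ ≃ constₚ (+ k) →
      ∃[ a ] ∃[ j ] ((2 * a + 1 + k ≡ j) × (f ≈ₚ pab a (j ∸ a)) × (g ≈ₚ pab (a + 1) (j ∸ a ∸ 1)))
    indices (descend s) _ _ y-x≃k =
      ⊥-elim (constₚ≄linGap {j = suc s} (≃-trans (≃-sym y-x≃k) (gap-descend s)))
    indices (inward {s} {a} {k′} _ 2a+1+k≡s) f≃x g≃y y-x≃k =
      a , s , subst (λ c → 2 * a + 1 + c ≡ s) k′≡k 2a+1+k≡s ,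
      ≃⇒≈ₚ f≃x , ≃⇒≈ₚ (subst (g ≃_) (⟦s,1+a⟧≡pab s a) g≃y)
      where
      k′≡k : k′ ≡ k
      k′≡k = constₚ-injective (≃-trans (≃-sym (gap-inward 2a+1+k≡s)) y-x≃k)
  to-pair : ∀ a j → 2 * a + 1 + k ≡ j → f ≈ₚ pab a (j ∸ a) → g ≈ₚ pab (a + 1) (j ∸ a ∸ 1) →
            PrimGapPair f g × (g -ₚ f) ≈ₚ constₚ (+ k)
  to-pair a j 2a+1+k≡j f≈x g≈y =
    ⋖⇒PrimGapPair (inward 1≤k 2a+1+k≡j) f≃x g≃y ,
    ≃⇒≈ₚ (≃-trans (-ₚ-cong g≃y f≃x) (gap-inward 2a+1+k≡j))
    where
    f≃x : f ≃ ⟦ j , a ⟧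
    f≃x = ≈ₚ⇒≃ f≈x
    g≃y : g ≃ ⟦ j , suc a ⟧
    g≃y = subst (g ≃_) (sym (⟦s,1+a⟧≡pab j a)) (≈ₚ⇒≃ g≈y)

corollary2p5 : (∀ d → IsPrimitiveGap d →
    (∃[ k ] (1 ≤ k × d ≈ₚ constₚ (+ k))) ⊎ (∃[ j ] (1 ≤ j × d ≈ₚ linGap j)))
    × (∀ j → 1 ≤ j →
    ∃[ f ] ∃[ g ] ((PrimGapPair f g × (g -ₚ f) ≈ₚ linGap j)
    × (∀ f′ g′ → PrimGapPair f′ g′ → (g′ -ₚ f′) ≈ₚ linGap j →
    (f′ ≈ₚ f) × (g′ ≈ₚ g))))
    × (∀ k → 1 ≤ k → ∀ f g →
    ((PrimGapPair f g × (g -ₚ f) ≈ₚ constₚ (+ k)) →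
    ∃[ a ] ∃[ j ] ((2 * a + 1 + k ≡ j)
    × (f ≈ₚ pab a (j ∸ a)) × (g ≈ₚ pab (a + 1) (j ∸ a ∸ 1))))
    × (∀ a j → 2 * a + 1 + k ≡ j → f ≈ₚ pab a (j ∸ a) → g ≈ₚ pab (a + 1) (j ∸ a ∸ 1) →
    PrimGapPair f g × (g -ₚ f) ≈ₚ constₚ (+ k)))
corollary2p5 = primitive-gap-shape , linear-gap-occurs-once , constant-gap-pairs
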